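{- For the wheel $W_n$ of order $n+1\geq 4$, $\gamma(C(W_n))=n$ if $n=4$, and $\gamma(C(W_n))=\lceil n/2\rceil+1$ otherwise.
   Context: The wheel $W_n$ is the graph of order $n+1$ obtained from a cycle $C_n$ by adding one new vertex adjacent to all vertices of the cycle. The central graph $C(G)$ of a simple graph $G$ is obtained from $G$ by subdividing each edge of $G$ exactly once and joining every pair of vertices non-adjacent in $G$ by an edge. $\gamma$ denotes the domination number. -}

module Defs where

open import Data.Nat using (ℕ; zero; suc; _≤_; _<_; _≡ᵇ_)
open import Data.Fin using (Fin; zero; suc; toℕ)
open import Data.Bool using (Bool; true; false; T; _∨_; _∧_)
open import Data.Product using (Σ; _×_; _,_; proj₁; proj₂)
open import Data.Sum using (_⊎_; inj₁; inj₂)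
open import Data.Empty using (⊥)
open import Data.List using (List; length)
open import Data.List.Relation.Unary.Any using (Any)
open import Relation.Binary.PropositionalEquality using (_≡_; _≢_)

record Graph : Set₁ where
  field
    Vertex : Set
    Adj    : Vertex → Vertex → Set
open Graph public

-- A (finite) simple graph on vertex set Fin m, with Boolean adjacency
-- (symmetry/irreflexivity hold for the wheel below by construction).
BGraph : ℕ → Set
BGraph m = Fin m → Fin m → Bool

toGraph : {m : ℕ} → BGraph m → Graph
toGraph {m} a = record { Vertex = Fin m ; Adj = λ u v → T (a u v) }

Dominating : (G : Graph) → List (Vertex G) → Set
Dominating G S = (v : Vertex G) → Any (λ u → u ≡ v ⊎ Adj G u v) S

-- γ(G) = k : some dominating set has k elements and every dominating set has ≥ k.
-- (Using lists: duplicates only increase length, so the minimum is the same.)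
IsDominationNumber : Graph → ℕ → Set
IsDominationNumber G k =
  Σ (List (Vertex G)) (λ S → Dominating G S × length S ≡ k)
  × ((S : List (Vertex G)) → Dominating G S → k ≤ length S)

Edge : {m : ℕ} → BGraph m → Set
Edge {m} a = Σ (Fin m × Fin m) (λ p → (toℕ (proj₁ p) < toℕ (proj₂ p)) × T (a (proj₁ p) (proj₂ p)))

-- Adjacency in the central graph C(G): vertices are original vertices and
-- subdivision vertices (one per edge).
CAdj : {m : ℕ} (a : BGraph m) → (Fin m ⊎ Edge a) → (Fin m ⊎ Edge a) → Set
CAdj a (inj₁ u) (inj₁ v) = (u ≢ v) × (a u v ≡ false)
CAdj a (inj₁ u) (inj₂ e) = (u ≡ proj₁ (proj₁ e)) ⊎ (u ≡ proj₂ (proj₁ e))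
CAdj a (inj₂ e) (inj₁ u) = (u ≡ proj₁ (proj₁ e)) ⊎ (u ≡ proj₂ (proj₁ e))
CAdj a (inj₂ e) (inj₂ f) = ⊥

central : {m : ℕ} → BGraph m → Graph
central {m} a = record { Vertex = Fin m ⊎ Edge a ; Adj = CAdj a }

cycleAdj : (n : ℕ) → BGraph n
cycleAdj n i j =
  (suc (toℕ i) ≡ᵇ toℕ j) ∨ (suc (toℕ j) ≡ᵇ toℕ i)
  ∨ ((toℕ i ≡ᵇ 0) ∧ (suc (toℕ j) ≡ᵇ n))
  ∨ ((toℕ j ≡ᵇ 0) ∧ (suc (toℕ i) ≡ᵇ n))

wheel : (n : ℕ) → BGraph (suc n)
wheel n zero    zero    = false
wheel n zero    (suc _) = true
wheel n (suc _) zero    = true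
wheel n (suc i) (suc j) = cycleAdj n i j

-- Away from the hub, the closed neighbourhoods {s_i, r_i} of the
-- spoke subdivision vertices s_i are disjoint, so a dominating set without the hub has at
-- least n elements.  With the hub, every other vertex dominates at most two of the n
-- subdivision vertices of rim edges, so n + 2 ≤ 2|S|.
-- Upper bound for n ≥ 5: the hub and the ⌈n/2⌉ even rim vertices.  Every rim edge has an
-- even end, and an odd rim vertex is non-adjacent in W_n, hence adjacent in C(W_n), to the
-- even rim vertex three steps away.  This fails for n = 4, where an exhaustive search shows
-- that no three vertices dominate C(W_4).

module Submission where

open import Defs
open import Data.Nat using (ℕ; zero; suc; _≡ᵇ_; _≤_; _<_; _+_; _*_; _∸_; ⌊_/2⌋; ⌈_/2⌉; z≤n; s≤s; _<?_)
open import Data.Nat.Properties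
open import Data.Fin using (Fin; zero; suc; toℕ; fromℕ; fromℕ<; inject₁) renaming (_≟_ to _≟ᶠ_)
open import Data.Fin.Properties using (injective⇒≤; toℕ-fromℕ; toℕ-fromℕ<; toℕ-inject₁; toℕ-injective; toℕ<n)
open import Data.Fin.Relation.Unary.Top using (view; ‵fromℕ; ‵inject₁)
open import Data.Bool using (Bool; T; _∨_; not)
open import Data.Bool.Properties using (T-≡; ¬-not; T-∨; T-∧; T-not-≡; T-irrelevant)
open import Data.Bool.ListAction using (all; any)
open import Data.Product using (∃-syntax; _×_; _,_; proj₁; proj₂)
open import Data.Product.Properties using (≡-dec)
open import Data.Sum using (_⊎_; inj₁; inj₂; [_,_]′) renaming (map to map⊎)
open import Data.Unit using (tt)
open import Data.List using (List; []; _∷_; length; map; concatMap; _++_; replicate; allFin; cartesianProduct; tabulate; lookup)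
open import Data.List.Properties using (length-++; length-replicate; length-tabulate)
open import Data.List.Relation.Unary.Any using (Any; here; there; index; any?)
open import Data.List.Relation.Unary.Any.Properties using (lookup-index; concatMap⁺; ++⁺ʳ; Any-⊎⁻; any⁺; any⁻)
import Data.List.Relation.Unary.Any as Any
open import Data.List.Relation.Unary.All.Properties using (all⁺; all⁻)
import Data.List.Relation.Unary.All as All
open import Data.List.Membership.Propositional using (_∈_)
open import Data.List.Membership.Propositional.Properties using (∈-allFin; ∈-cartesianProduct⁺; ∈-tabulate⁺; ∈-++⁺ˡ; ∈-++⁺ʳ; ∈-map⁺)
open import Function using (_∘_; Injective)
open import Function.Bundles using (Equivalence)
open import Relation.Nullary using (¬_; Dec; yes; no; _×-dec_; contradiction)
open import Relation.Nullary.Decidable using (⌊_⌋; T?; toWitness; fromWitness)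
open import Relation.Binary.PropositionalEquality using (_≡_; _≢_; refl; sym; trans; cong; subst; module ≡-Reasoning)

all-∈⇒≤-length : ∀ {N} {xs : List (Fin N)} → (∀ i → i ∈ xs) → N ≤ length xs
all-∈⇒≤-length {xs = xs} i∈xs = injective⇒≤ index-injective
  where
    index-injective : Injective _≡_ _≡_ (λ i → index (i∈xs i))
    index-injective {i} {j} eq =
      trans (lookup-index (i∈xs i)) (trans (cong (lookup xs) eq) (sym (lookup-index (i∈xs j))))

length-concatMap-≤ : ∀ {A B : Set} {k} (f : A → List B) → (∀ x → length (f x) ≤ k) →
                     ∀ xs → length (concatMap f xs) ≤ k * length xs
length-concatMap-≤ f bound [] = z≤n
length-concatMap-≤ {k = k} f bound (x ∷ xs) = begin
  length (f x ++ concatMap f xs)         ≡⟨ length-++ (f x) ⟩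
  length (f x) + length (concatMap f xs) ≤⟨ +-mono-≤ (bound x) (length-concatMap-≤ f bound xs) ⟩
  k + k * length xs                      ≡⟨ sym (*-suc k (length xs)) ⟩
  k * suc (length xs)                    ∎
  where open ≤-Reasoning

labelling-≤ : ∀ {A : Set} {N k} (label : A → List (Fin N)) → (∀ x → length (label x) ≤ k) →
              {xs : List A} → (∀ i → Any (λ x → i ∈ label x) xs) → N ≤ k * length xs
labelling-≤ label bound {xs} carried =
  ≤-trans (all-∈⇒≤-length (λ i → concatMap⁺ label (carried i))) (length-concatMap-≤ label bound xs)

-- Deciding domination in central graphs

Dominating-++ : ∀ {G} P {S} → Dominating G S → Dominating G (P ++ S)
Dominating-++ P dom v = ++⁺ʳ P (dom v)

allOfLengthᵇ : {A : Set} → List A → ℕ → (List A → Bool) → Bool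
allOfLengthᵇ xs zero    p = p []
allOfLengthᵇ xs (suc k) p = all (λ x → allOfLengthᵇ xs k (p ∘ (x ∷_))) xs

allOfLengthᵇ-sound : ∀ {A : Set} {xs : List A} → (∀ x → x ∈ xs) →
                     ∀ k p → T (allOfLengthᵇ xs k p) → ∀ ys → length ys ≡ k → T (p ys)
allOfLengthᵇ-sound complete zero p holds [] refl = holds
allOfLengthᵇ-sound complete (suc k) p holds (y ∷ ys) refl =
  allOfLengthᵇ-sound complete k (p ∘ (y ∷_)) (All.lookup (all⁺ _ _ holds) (complete y)) ys refl

module CentralGraph {m : ℕ} (a : BGraph m) where

  V : Set
  V = Vertex (central a)

  IsEdge : Fin m × Fin m → Set
  IsEdge (x , y) = toℕ x < toℕ y × T (a x y)

  isEdge? : ∀ p → Dec (IsEdge p)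
  isEdge? (x , y) = (toℕ x <? toℕ y) ×-dec T? (a x y)

  edge-≡ : {e f : Edge a} → proj₁ e ≡ proj₁ f → e ≡ f
  edge-≡ {_ , lt , t} {_ , lt′ , t′} refl
    rewrite <-irrelevant lt lt′ | T-irrelevant t t′ = refl

  edgesAmong : List (Fin m × Fin m) → List (Edge a)
  edgesAmong [] = []
  edgesAmong (p ∷ ps) with isEdge? p
  ... | yes e = (p , e) ∷ edgesAmong ps
  ... | no _  = edgesAmong ps

  ∈-edgesAmong : ∀ {ps} (e : Edge a) → proj₁ e ∈ ps → e ∈ edgesAmong ps
  ∈-edgesAmong {p ∷ ps} e p∈ps with isEdge? p | p∈ps
  ... | yes _   | here refl = here (edge-≡ refl)
  ... | no ¬e   | here refl = contradiction (proj₂ e) ¬e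
  ... | yes _   | there mem = there (∈-edgesAmong e mem)
  ... | no _    | there mem = ∈-edgesAmong e mem

  vertices : List V
  vertices = map inj₁ (allFin m) ++ map inj₂ (edgesAmong (cartesianProduct (allFin m) (allFin m)))

  ∈-vertices : ∀ v → v ∈ vertices
  ∈-vertices (inj₁ u) = ∈-++⁺ˡ (∈-map⁺ inj₁ (∈-allFin u))
  ∈-vertices (inj₂ e@((x , y) , _)) =
    ∈-++⁺ʳ (map inj₁ (allFin m)) (∈-map⁺ inj₂ (∈-edgesAmong e (∈-cartesianProduct⁺ (∈-allFin x) (∈-allFin y))))

  ClosedAdj : V → V → Set
  ClosedAdj u v = u ≡ v ⊎ CAdj a u v

  closedᵇ : V → V → Bool
  closedᵇ (inj₁ u)             (inj₁ v)             = ⌊ u ≟ᶠ v ⌋ ∨ not (a u v)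
  closedᵇ (inj₁ u)             (inj₂ ((x , y) , _)) = ⌊ u ≟ᶠ x ⌋ ∨ ⌊ u ≟ᶠ y ⌋
  closedᵇ (inj₂ ((x , y) , _)) (inj₁ u)             = ⌊ u ≟ᶠ x ⌋ ∨ ⌊ u ≟ᶠ y ⌋
  closedᵇ (inj₂ (p , _))       (inj₂ (q , _))       = ⌊ ≡-dec _≟ᶠ_ _≟ᶠ_ p q ⌋

  closedᵇ-complete : ∀ {u v} → ClosedAdj u v → T (closedᵇ u v)
  closedᵇ-complete {inj₁ u} (inj₁ refl) = Equivalence.from T-∨ (inj₁ (fromWitness {a? = u ≟ᶠ u} refl))
  closedᵇ-complete {inj₂ (p , _)} (inj₁ refl) = fromWitness {a? = ≡-dec _≟ᶠ_ _≟ᶠ_ p p} refl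
  closedᵇ-complete {inj₁ _} {inj₁ _} (inj₂ (_ , non-adjacent)) =
    Equivalence.from T-∨ (inj₂ (Equivalence.from T-not-≡ non-adjacent))
  closedᵇ-complete {inj₁ u} {inj₂ ((x , y) , _)} (inj₂ end) =
    Equivalence.from T-∨ (map⊎ (fromWitness {a? = u ≟ᶠ x}) (fromWitness {a? = u ≟ᶠ y}) end)
  closedᵇ-complete {inj₂ ((x , y) , _)} {inj₁ u} (inj₂ end) =
    Equivalence.from T-∨ (map⊎ (fromWitness {a? = u ≟ᶠ x}) (fromWitness {a? = u ≟ᶠ y}) end)
  closedᵇ-complete {inj₂ _} {inj₂ _} (inj₂ ())

  closedᵇ-sound : ∀ u v → T (closedᵇ u v) → ClosedAdj u v
  closedᵇ-sound (inj₁ u) (inj₁ v) t with u ≟ᶠ v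
  ... | yes refl = inj₁ refl
  ... | no u≢v   = inj₂ (u≢v , Equivalence.to T-not-≡ t)
  closedᵇ-sound (inj₁ u) (inj₂ ((x , y) , _)) t =
    inj₂ (map⊎ (toWitness {a? = u ≟ᶠ x}) (toWitness {a? = u ≟ᶠ y}) (Equivalence.to T-∨ t))
  closedᵇ-sound (inj₂ ((x , y) , _)) (inj₁ u) t =
    inj₂ (map⊎ (toWitness {a? = u ≟ᶠ x}) (toWitness {a? = u ≟ᶠ y}) (Equivalence.to T-∨ t))
  closedᵇ-sound (inj₂ _) (inj₂ _) t = inj₁ (cong inj₂ (edge-≡ (toWitness t)))

  ∈-dominates : ∀ {S u v} → u ∈ S → ClosedAdj u v → Any (λ w → ClosedAdj w v) S
  ∈-dominates u∈S closed = Any.map (λ { refl → closed }) u∈S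

  dominatesᵇ : List V → Bool
  dominatesᵇ S = all (λ v → any (λ u → closedᵇ u v) S) vertices

  dominatesᵇ-complete : ∀ {S} → Dominating (central a) S → T (dominatesᵇ S)
  dominatesᵇ-complete dom =
    all⁻ _ {vertices} (All.tabulate λ {v} _ → any⁺ _ (Any.map closedᵇ-complete (dom v)))

  dominatesᵇ-sound : ∀ S → T (dominatesᵇ S) → Dominating (central a) S
  dominatesᵇ-sound S t v =
    Any.map (λ {u} → closedᵇ-sound u v) (any⁻ _ S (All.lookup (all⁺ _ vertices t) (∈-vertices v)))

  -- Padding with copies of any vertex x reduces a short dominating set to one of length exactly k.
  dominating-longer-than : ∀ k (x : V) → T (allOfLengthᵇ vertices k (not ∘ dominatesᵇ)) →
                           ∀ {S} → Dominating (central a) S → k < length S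
  dominating-longer-than k x none {S} dom with k <? length S
  ... | yes k<|S| = k<|S|
  ... | no  k≮|S| = contradiction (dominatesᵇ-complete (Dominating-++ padding dom)) padded-fails
    where
      padding = replicate (k ∸ length S) x

      length-padded : length (padding ++ S) ≡ k
      length-padded = trans (length-++ padding)
        (trans (cong (_+ length S) (length-replicate (k ∸ length S))) (m∸n+n≡m (≮⇒≥ k≮|S|)))

      padded-fails : ¬ T (dominatesᵇ (padding ++ S))
      padded-fails = subst T (Equivalence.to T-not-≡
        (allOfLengthᵇ-sound ∈-vertices k _ none (padding ++ S) length-padded))

data CycleAdjacent (n : ℕ) : ℕ → ℕ → Set where
  forward  : ∀ {x} → CycleAdjacent n x (suc x)
  backward : ∀ {x} → CycleAdjacent n (suc x) x
  wrap     : ∀ {x} → suc x ≡ n → CycleAdjacent n 0 x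
  unwrap   : ∀ {x} → suc x ≡ n → CycleAdjacent n x 0

cycleAdj⇒CycleAdjacent : ∀ {n} (i j : Fin n) → T (cycleAdj n i j) → CycleAdjacent n (toℕ i) (toℕ j)
cycleAdj⇒CycleAdjacent {n} i j t with Equivalence.to T-∨ t
... | inj₁ i+1≡j = subst (CycleAdjacent n (toℕ i)) (≡ᵇ⇒≡ _ _ i+1≡j) forward
... | inj₂ t′ with Equivalence.to T-∨ t′
...   | inj₁ j+1≡i = subst (λ x → CycleAdjacent n x (toℕ j)) (≡ᵇ⇒≡ _ _ j+1≡i) backward
...   | inj₂ t″ with Equivalence.to T-∨ t″
...     | inj₁ ends = let i≡0 , j+1≡n = Equivalence.to T-∧ ends in
          subst (λ x → CycleAdjacent n x (toℕ j)) (sym (≡ᵇ⇒≡ _ _ i≡0)) (wrap (≡ᵇ⇒≡ _ _ j+1≡n))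
...     | inj₂ ends = let j≡0 , i+1≡n = Equivalence.to T-∧ ends in
          subst (CycleAdjacent n (toℕ i)) (sym (≡ᵇ⇒≡ _ _ j≡0)) (unwrap (≡ᵇ⇒≡ _ _ i+1≡n))

cycleAdj-step : ∀ {n} (i j : Fin n) → suc (toℕ i) ≡ toℕ j → T (cycleAdj n i j)
cycleAdj-step i j i+1≡j = Equivalence.from (T-∨ {suc (toℕ i) ≡ᵇ toℕ j}) (inj₁ (≡⇒≡ᵇ _ _ i+1≡j))

cycleAdj-wrap : ∀ {n} (j : Fin (suc n)) → toℕ j ≡ n → T (cycleAdj (suc n) zero j)
cycleAdj-wrap {n} j j≡n =
  Equivalence.from (T-∨ {1 ≡ᵇ toℕ j}) (inj₂ (Equivalence.from (T-∨ {toℕ j ≡ᵇ n}) (inj₁ (≡⇒≡ᵇ _ _ j≡n))))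

hub : ∀ {n} → Vertex (central (wheel n))
hub = inj₁ zero

rim : ∀ {n} → Fin n → Vertex (central (wheel n))
rim i = inj₁ (suc i)

spoke : ∀ {n} → Fin n → Vertex (central (wheel n))
spoke i = inj₂ ((zero , suc i) , s≤s z≤n , tt)

hub? : ∀ {n} (v : Vertex (central (wheel n))) → Dec (v ≡ hub)
hub? (inj₁ zero)    = yes refl
hub? (inj₁ (suc _)) = no λ ()
hub? (inj₂ _)       = no λ ()

prev : ∀ {m} → Fin (suc m) → Fin (suc m)
prev {m} zero = fromℕ m
prev (suc i)  = inject₁ i

-- Lower bound

module _ {n : ℕ} where
  open CentralGraph (wheel n) using (ClosedAdj)

  spokeLabel : Vertex (central (wheel n)) → List (Fin n)
  spokeLabel (inj₁ zero)              = []
  spokeLabel (inj₁ (suc i))           = i ∷ []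
  spokeLabel (inj₂ ((_ , zero) , _))  = []
  spokeLabel (inj₂ ((_ , suc i) , _)) = i ∷ []

  spokeLabel-length : ∀ v → length (spokeLabel v) ≤ 1
  spokeLabel-length (inj₁ zero)              = z≤n
  spokeLabel-length (inj₁ (suc _))           = ≤-refl
  spokeLabel-length (inj₂ ((_ , zero) , _))  = z≤n
  spokeLabel-length (inj₂ ((_ , suc _) , _)) = ≤-refl

  spoke-neighbour : ∀ {i u} → ClosedAdj u (spoke i) → u ≡ hub ⊎ i ∈ spokeLabel u
  spoke-neighbour (inj₁ refl)                     = inj₂ (here refl)
  spoke-neighbour {u = inj₁ _} (inj₂ (inj₁ refl)) = inj₁ refl
  spoke-neighbour {u = inj₁ _} (inj₂ (inj₂ refl)) = inj₂ (here refl)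
  spoke-neighbour {u = inj₂ _} (inj₂ ())

  hubless-dominating-≥ : ∀ {S} → ¬ Any (_≡ hub) S → Dominating (central (wheel n)) S → n ≤ length S
  hubless-dominating-≥ {S} no-hub dom =
    subst (n ≤_) (*-identityˡ (length S)) (labelling-≤ spokeLabel spokeLabel-length carried)
    where
      carried : ∀ i → Any (λ x → i ∈ spokeLabel x) S
      carried i = [ (λ hub∈S → contradiction hub∈S no-hub) , (λ i∈S → i∈S) ]′
                    (Any-⊎⁻ (Any.map spoke-neighbour (dom (spoke i))))

module _ {k : ℕ} where
  open CentralGraph (wheel (2 + k)) using (ClosedAdj)

  -- Label 2 + j stands for the rim edge joining rims j and j + 1 (mod n); the hub carries
  -- the two spare labels 0 and 1, which is what turns the count into n + 2 ≤ 2 |S|.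
  rimEdgeLabel : Vertex (central (wheel (2 + k))) → List (Fin (2 + (2 + k)))
  rimEdgeLabel (inj₁ zero)          = zero ∷ suc zero ∷ []
  rimEdgeLabel (inj₁ (suc i))       = suc (suc i) ∷ suc (suc (prev i)) ∷ []
  rimEdgeLabel (inj₂ ((x , y) , _)) = suc x ∷ suc y ∷ []

  rimEdgeLabel-length : ∀ v → length (rimEdgeLabel v) ≤ 2
  rimEdgeLabel-length (inj₁ zero)    = ≤-refl
  rimEdgeLabel-length (inj₁ (suc _)) = ≤-refl
  rimEdgeLabel-length (inj₂ _)       = ≤-refl

  rimEdge : Fin (suc k) → Vertex (central (wheel (2 + k)))
  rimEdge i = inj₂ ((suc (inject₁ i) , suc (suc i)) ,
                    s≤s (s≤s (≤-reflexive (toℕ-inject₁ i))) ,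
                    cycleAdj-step (inject₁ i) (suc i) (cong suc (toℕ-inject₁ i)))

  wrapEdge : Vertex (central (wheel (2 + k)))
  wrapEdge = inj₂ ((suc zero , suc (fromℕ (suc k))) , s≤s (s≤s z≤n) ,
                   cycleAdj-wrap (fromℕ (suc k)) (toℕ-fromℕ (suc k)))

  rimEdge-neighbour : ∀ {i u} → ClosedAdj u (rimEdge i) → suc (suc (inject₁ i)) ∈ rimEdgeLabel u
  rimEdge-neighbour (inj₁ refl)                     = here refl
  rimEdge-neighbour {u = inj₁ _} (inj₂ (inj₁ refl)) = here refl
  rimEdge-neighbour {u = inj₁ _} (inj₂ (inj₂ refl)) = there (here refl)
  rimEdge-neighbour {u = inj₂ _} (inj₂ ())

  wrapEdge-neighbour : ∀ {u} → ClosedAdj u wrapEdge → suc (suc (fromℕ (suc k))) ∈ rimEdgeLabel u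
  wrapEdge-neighbour (inj₁ refl)                     = there (here refl)
  wrapEdge-neighbour {u = inj₁ _} (inj₂ (inj₁ refl)) = there (here refl)
  wrapEdge-neighbour {u = inj₁ _} (inj₂ (inj₂ refl)) = here refl
  wrapEdge-neighbour {u = inj₂ _} (inj₂ ())

  hub-dominating-≥ : ∀ {S} → Any (_≡ hub) S → Dominating (central (wheel (2 + k))) S →
                     2 + (2 + k) ≤ 2 * length S
  hub-dominating-≥ {S} hub∈S dom = labelling-≤ rimEdgeLabel rimEdgeLabel-length carried
    where
      carried : ∀ t → Any (λ x → t ∈ rimEdgeLabel x) S
      carried zero          = Any.map (λ { refl → here refl }) hub∈S
      carried (suc zero)    = Any.map (λ { refl → there (here refl) }) hub∈S
      carried (suc (suc j)) with view j
      ... | ‵fromℕ     = Any.map wrapEdge-neighbour (dom wrapEdge)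
      ... | ‵inject₁ i = Any.map rimEdge-neighbour (dom (rimEdge i))

n≤2*m⇒⌈n/2⌉≤m : ∀ {n m} → n ≤ 2 * m → ⌈ n /2⌉ ≤ m
n≤2*m⇒⌈n/2⌉≤m {n} {m} n≤2m = begin
  ⌈ n /2⌉           ≤⟨ ⌈n/2⌉-mono n≤2m ⟩
  ⌈ m + (m + 0) /2⌉ ≡⟨ cong (λ x → ⌈ m + x /2⌉) (+-identityʳ m) ⟩
  ⌈ m + m /2⌉       ≡⟨ sym (n≡⌈n+n/2⌉ m) ⟩
  m                 ∎
  where open ≤-Reasoning

dominating-≥⌈n/2⌉+1 : ∀ k {S} → Dominating (central (wheel (2 + k))) S → ⌈ 2 + k /2⌉ + 1 ≤ length S
dominating-≥⌈n/2⌉+1 k {S} dom with any? hub? S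
... | yes hub∈S = subst (_≤ length S) (+-comm 1 ⌈ 2 + k /2⌉)
                        (n≤2*m⇒⌈n/2⌉≤m (hub-dominating-≥ hub∈S dom))
... | no  no-hub = ≤-trans (subst (_≤ 2 + k) (+-comm 1 ⌈ 2 + k /2⌉) (⌈n/2⌉<n k))
                           (hubless-dominating-≥ no-hub dom)

-- Upper bound for n ≥ 5

Even Odd : ℕ → Set
Even x = ∃[ q ] x ≡ q + q
Odd  x = ∃[ q ] x ≡ suc (q + q)

odd⇒suc-even : ∀ {x} → Odd x → Even (suc x)
odd⇒suc-even (q , refl) = suc q , cong suc (sym (+-suc q q))

even-or-odd : ∀ x → Even x ⊎ Odd x
even-or-odd zero = inj₁ (0 , refl)
even-or-odd (suc x) with even-or-odd x
... | inj₁ (q , refl) = inj₂ (q , refl)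
... | inj₂ x-odd      = inj₁ (odd⇒suc-even x-odd)

CycleAdjacent⇒even-end : ∀ {n x y} → CycleAdjacent n x y → Even x ⊎ Even y
CycleAdjacent⇒even-end {x = x} forward with even-or-odd x
... | inj₁ x-even = inj₁ x-even
... | inj₂ x-odd  = inj₂ (odd⇒suc-even x-odd)
CycleAdjacent⇒even-end {y = y} backward with even-or-odd y
... | inj₁ y-even = inj₂ y-even
... | inj₂ y-odd  = inj₁ (odd⇒suc-even y-odd)
CycleAdjacent⇒even-end (wrap _)   = inj₁ (0 , refl)
CycleAdjacent⇒even-end (unwrap _) = inj₂ (0 , refl)

ThreeApart : ℕ → ℕ → Set
ThreeApart x y = x ≡ 3 + y ⊎ y ≡ 3 + x

ThreeApart-irreflexive : ∀ {x} → ¬ ThreeApart x x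
ThreeApart-irreflexive (inj₁ ())
ThreeApart-irreflexive (inj₂ ())

-- y is x + 3 when that is < n, and x − 3 otherwise; then n ≤ x + 3 and 5 ≤ n force the odd x ≥ 3.
odd-three-apart-even : ∀ {n x} → 5 ≤ n → x < n → Odd x → ∃[ y ] y < n × Even y × ThreeApart y x
odd-three-apart-even {n} 5≤n x<n (q , refl) with 3 + suc (q + q) <? n
... | yes up<n = 3 + suc (q + q) , up<n , (suc (suc q) , up-even) , inj₁ refl
  where
    up-even : 3 + suc (q + q) ≡ suc (suc q) + suc (suc q)
    up-even = cong (2 +_) (sym (trans (+-suc q (suc q)) (cong suc (+-suc q q))))
odd-three-apart-even 5≤n x<n (zero  , refl) | no up≮n = contradiction 5≤n up≮n
odd-three-apart-even {n} 5≤n x<n (suc r , refl) | no _ =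
  r + r , <-trans (m<n+m (r + r) {3} (s≤s z≤n)) (subst (_< n) x≡3+2r x<n) , (r , refl) , inj₂ x≡3+2r
  where
    x≡3+2r : suc (suc r + suc r) ≡ 3 + (r + r)
    x≡3+2r = cong (2 +_) (+-suc r r)

three-apart-not-CycleAdjacent : ∀ {n x y} → n ≢ 4 → ThreeApart x y → ¬ CycleAdjacent n x y
three-apart-not-CycleAdjacent n≢4 (inj₁ refl) (unwrap refl) = n≢4 refl
three-apart-not-CycleAdjacent n≢4 (inj₂ refl) (wrap refl)   = n≢4 refl

three-apart-rims-adjacent : ∀ {n} {i j : Fin n} → n ≢ 4 → ThreeApart (toℕ i) (toℕ j) →
                            CAdj (wheel n) (rim i) (rim j)
three-apart-rims-adjacent {i = i} {j} n≢4 apart =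
  distinct , ¬-not (λ adjacent → three-apart-not-CycleAdjacent n≢4 apart
                     (cycleAdj⇒CycleAdjacent i j (Equivalence.from T-≡ adjacent)))
  where
    distinct : suc i ≢ suc j
    distinct refl = ThreeApart-irreflexive apart

q+q<n⇒q<⌈n/2⌉ : ∀ {q n} → q + q < n → q < ⌈ n /2⌉
q+q<n⇒q<⌈n/2⌉ {q} {n} q+q<n = begin-strict
  q                   ≡⟨ n≡⌊n+n/2⌋ q ⟩
  ⌊ q + q /2⌋         <⟨ n<1+n _ ⟩
  ⌈ suc (q + q) /2⌉   ≤⟨ ⌈n/2⌉-mono q+q<n ⟩
  ⌈ n /2⌉             ∎
  where open ≤-Reasoning

q<⌈n/2⌉⇒q+q<n : ∀ {q n} → q < ⌈ n /2⌉ → q + q < n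
q<⌈n/2⌉⇒q+q<n {zero}  {suc n}       _             = s≤s z≤n
q<⌈n/2⌉⇒q+q<n {suc q} {suc (suc n)} (s≤s q<⌈n/2⌉) =
  s≤s (subst (_< suc n) (sym (+-suc q q)) (s≤s (q<⌈n/2⌉⇒q+q<n q<⌈n/2⌉)))
q<⌈n/2⌉⇒q+q<n {suc q} {suc zero}    (s≤s ())

module _ {n : ℕ} where
  open CentralGraph (wheel n) using (∈-dominates)

  evenRim : Fin ⌈ n /2⌉ → Fin n
  evenRim q = fromℕ< (q<⌈n/2⌉⇒q+q<n {toℕ q} (toℕ<n q))

  hubAndEvenRims : List (Vertex (central (wheel n)))
  hubAndEvenRims = hub ∷ tabulate (rim ∘ evenRim)

  length-hubAndEvenRims : length hubAndEvenRims ≡ ⌈ n /2⌉ + 1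
  length-hubAndEvenRims = trans (cong suc (length-tabulate (rim ∘ evenRim))) (+-comm 1 ⌈ n /2⌉)

  even-rim-∈ : ∀ {i} → Even (toℕ i) → rim i ∈ hubAndEvenRims
  even-rim-∈ {i} (q , i≡q+q) =
    there (subst (_∈ tabulate (rim ∘ evenRim)) (cong rim evenRim-q≡i) (∈-tabulate⁺ q′))
    where
      q′ : Fin ⌈ n /2⌉
      q′ = fromℕ< (q+q<n⇒q<⌈n/2⌉ {q} (subst (_< n) i≡q+q (toℕ<n i)))

      evenRim-q≡i : evenRim q′ ≡ i
      evenRim-q≡i = toℕ-injective (begin
        toℕ (evenRim q′)    ≡⟨ toℕ-fromℕ< _ ⟩
        toℕ q′ + toℕ q′     ≡⟨ cong (λ x → x + x) (toℕ-fromℕ< {m = q} _) ⟩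
        q + q               ≡⟨ sym i≡q+q ⟩
        toℕ i               ∎)
        where open ≡-Reasoning

  hubAndEvenRims-dominating : 5 ≤ n → Dominating (central (wheel n)) hubAndEvenRims
  hubAndEvenRims-dominating _ (inj₁ zero) = here (inj₁ refl)
  hubAndEvenRims-dominating 5≤n (inj₁ (suc i)) with even-or-odd (toℕ i)
  ... | inj₁ i-even = ∈-dominates (even-rim-∈ i-even) (inj₁ refl)
  ... | inj₂ i-odd with odd-three-apart-even 5≤n (toℕ<n i) i-odd
  ...   | y , y<n , y-even , apart =
    ∈-dominates (even-rim-∈ (subst Even (sym toℕj≡y) y-even))
                (inj₂ (three-apart-rims-adjacent n≢4 (subst (λ z → ThreeApart z (toℕ i)) (sym toℕj≡y) apart)))
    where
      toℕj≡y : toℕ (fromℕ< y<n) ≡ y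
      toℕj≡y = toℕ-fromℕ< y<n

      n≢4 : n ≢ 4
      n≢4 n≡4 = <⇒≢ 5≤n (sym n≡4)
  hubAndEvenRims-dominating _ (inj₂ ((zero , _) , _))      = here (inj₂ (inj₁ refl))
  hubAndEvenRims-dominating _ (inj₂ ((suc _ , zero) , _))  = here (inj₂ (inj₂ refl))
  hubAndEvenRims-dominating _ (inj₂ ((suc p , suc r) , _ , adjacent))
    with CycleAdjacent⇒even-end (cycleAdj⇒CycleAdjacent p r adjacent)
  ... | inj₁ p-even = ∈-dominates (even-rim-∈ p-even) (inj₂ (inj₁ refl))
  ... | inj₂ r-even = ∈-dominates (even-rim-∈ r-even) (inj₂ (inj₂ refl))

hubRimEdge₃ : List (Vertex (central (wheel 3)))
hubRimEdge₃ = hub ∷ rim zero ∷ inj₂ ((suc (suc zero) , suc (suc (suc zero))) , s≤s (s≤s (s≤s z≤n)) , tt) ∷ []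

hubThreeRims₄ : List (Vertex (central (wheel 4)))
hubThreeRims₄ = hub ∷ rim zero ∷ rim (suc zero) ∷ rim (suc (suc zero)) ∷ []

theorem4p4 : (n : ℕ) → 3 ≤ n →
    (n ≡ 4 → IsDominationNumber (central (wheel n)) n)
    × (n ≢ 4 → IsDominationNumber (central (wheel n)) (⌈ n /2⌉ + 1))
theorem4p4 1 (s≤s ())
theorem4p4 2 (s≤s (s≤s ()))
theorem4p4 3 _ =
  (λ ()) ,
  λ _ → (hubRimEdge₃ , CentralGraph.dominatesᵇ-sound (wheel 3) hubRimEdge₃ tt , refl) ,
        λ _ → dominating-≥⌈n/2⌉+1 1
theorem4p4 4 _ =
  (λ _ → (hubThreeRims₄ , CentralGraph.dominatesᵇ-sound (wheel 4) hubThreeRims₄ tt , refl) ,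
         λ _ → CentralGraph.dominating-longer-than (wheel 4) 3 hub tt) ,
  λ 4≢4 → contradiction refl 4≢4
theorem4p4 (suc (suc (suc (suc (suc k))))) _ =
  (λ ()) ,
  λ _ → (hubAndEvenRims , hubAndEvenRims-dominating 5≤n , length-hubAndEvenRims) ,
        λ _ → dominating-≥⌈n/2⌉+1 (3 + k)
  where
    5≤n : 5 ≤ 5 + k
    5≤n = m≤m+n 5 k
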